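{- Let $n\ge2$, let $\lambda$ be a proper permutation of size $m$, and let $f\colon[m]\to[2n+2]$ be a function. Then $f$ is an embedding of $\lambda$ into $\pi_n$ if and only if: (1) $f(i)<f(i+1)$ for every $i\in[m-1]$; (2) if $i$ is a top position of $\lambda$ then $f(i)$ is a left or top position of $\pi_n$, and if $i$ is a bottom position of $\lambda$ then $f(i)$ is a bottom or right position of $\pi_n$; (3) at most one of the two values $1$ and $2n+2$ lies in the image of $f$.
   Context: Permutations of size $m$ are bijections of $[m]$ written as value sequences. An embedding of $\sigma\in\mathcal{S}_k$ into $\pi\in\mathcal{S}_N$ is a strictly increasing $f\colon[k]\to[N]$ with $\pi(f(1)),\dots,\pi(f(k))$ order-isomorphic to $\sigma$; $\sigma\le\pi$ iff one exists; $[x,y)=\{z:x\le z<y\}$. For $n\ge1$, $\pi_n\in\mathcal{S}_{2n+2}$ is given by $\pi_n(1)=n+1$, $\pi_n(2i)=i$ and $\pi_n(2i+1)=n+2+i$ for $1\le i\le n$, $\pi_n(2n+2)=n+2$. Position $1$ of $\pi_n$ is its left position, position $2n+2$ its right position, positions $2,4,\dots,2n$ (values $1,\dots,n$) its bottom positions, and positions $3,5,\dots,2n+1$ (values $n+3,\dots,2n+2$) its top positions. An inverse descent of $\lambda$ is a pair $i<j$ with $\lambda(i)=\lambda(j)+1$. If $\lambda$ has exactly one inverse descent, at $i<j$, then $\lambda(k)$ is a top element (and $k$ a top position of $\lambda$) if $\lambda(k)\ge\lambda(i)$, and a bottom element (bottom position) if $\lambda(k)\le\lambda(j)$; a top (bottom)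 repetition is a pair of consecutive elements both top (bottom). A permutation $\lambda$ with $21\le\lambda<\pi_n$ of size $m$ is proper if: (1) it has exactly one inverse descent; (2) $\lambda(1),\lambda(m-1)$ are top elements and $\lambda(2),\lambda(m)$ are bottom elements (for $m=2$, $\lambda=21$); (3) it has at most one top repetition and at most one bottom repetition, and if both, the top repetition is to the left of the bottom one. -}

module Defs where

open import Data.Nat using (ℕ; zero; suc; _+_; _*_; _≤_; _<_; _≡ᵇ_; _/_; _%_)
open import Data.Fin using (Fin; toℕ; cast)
import Data.Fin as F
open import Data.Bool using (if_then_else_)
open import Data.Product using (Σ; ∃; _×_; _,_)
open import Data.Sum using (_⊎_)
open import Relation.Binary.PropositionalEquality using (_≡_)
open import Relation.Nullary using (¬_)
open import Function.Definitions using (Injective)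

-- Conventions: a permutation of size m is given by its value sequence
-- σ : Fin m → ℕ, where position p : Fin m stands for the (1-based)
-- position toℕ p + 1, and the values are the 1-based numbers 1..m.

IsPerm : (m : ℕ) → (Fin m → ℕ) → Set
IsPerm m σ = (∀ i → (1 ≤ σ i) × (σ i ≤ m)) × Injective _≡_ _≡_ σ

OrderIso : {k : ℕ} → (Fin k → ℕ) → (Fin k → ℕ) → Set
OrderIso {k} σ τ = ∀ (i j : Fin k) → ((σ i < σ j → τ i < τ j) × (τ i < τ j → σ i < σ j))

IsEmbedding : {k N : ℕ} → (Fin k → ℕ) → (Fin N → ℕ) → (Fin k → Fin N) → Set
IsEmbedding {k} σ π f =
  (∀ (i j : Fin k) → i F.< j → f i F.< f j) × OrderIso σ (λ i → π (f i))

Contains : {k N : ℕ} → (Fin k → ℕ) → (Fin N → ℕ) → Set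
Contains {k} {N} σ π = Σ (Fin k → Fin N) λ f → IsEmbedding σ π f

SamePerm : {k N : ℕ} → (Fin k → ℕ) → (Fin N → ℕ) → Set
SamePerm {k} {N} σ π = Σ (k ≡ N) λ e → ∀ (i : Fin k) → σ i ≡ π (cast e i)

p21 : Fin 2 → ℕ
p21 F.zero = 2
p21 (F.suc _) = 1

piNat : ℕ → ℕ → ℕ
piNat n q =
  if q ≡ᵇ 1 then suc n
  else if q ≡ᵇ (2 * n + 2) then n + 2
  else if (q % 2) ≡ᵇ 0 then q / 2
  else n + 2 + q / 2

piPerm : (n : ℕ) → Fin (2 * n + 2) → ℕ
piPerm n p = piNat n (suc (toℕ p))

LeftPos : (n : ℕ) → Fin (2 * n + 2) → Set
LeftPos n p = suc (toℕ p) ≡ 1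

RightPos : (n : ℕ) → Fin (2 * n + 2) → Set
RightPos n p = suc (toℕ p) ≡ 2 * n + 2

BottomPosπ : (n : ℕ) → Fin (2 * n + 2) → Set
BottomPosπ n p = ∃ λ i → (1 ≤ i) × (i ≤ n) × (suc (toℕ p) ≡ 2 * i)

TopPosπ : (n : ℕ) → Fin (2 * n + 2) → Set
TopPosπ n p = ∃ λ i → (1 ≤ i) × (i ≤ n) × (suc (toℕ p) ≡ 2 * i + 1)

InvDescent : {m : ℕ} → (Fin m → ℕ) → Fin m → Fin m → Set
InvDescent σ i j = (i F.< j) × (σ i ≡ σ j + 1)

ExactlyOneInvDescent : {m : ℕ} → (Fin m → ℕ) → Set
ExactlyOneInvDescent {m} σ =
  Σ (Fin m) λ i → Σ (Fin m) λ j → InvDescent σ i j ×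
    (∀ i' j' → InvDescent σ i' j' → (i' ≡ i) × (j' ≡ j))

TopPos : {m : ℕ} → (Fin m → ℕ) → Fin m → Set
TopPos σ k = ∃ λ i → ∃ λ j → InvDescent σ i j × (σ i ≤ σ k)

BottomPos : {m : ℕ} → (Fin m → ℕ) → Fin m → Set
BottomPos σ k = ∃ λ i → ∃ λ j → InvDescent σ i j × (σ k ≤ σ j)

TopRep : {m : ℕ} → (Fin m → ℕ) → Fin m → Set
TopRep {m} σ k = Σ (Fin m) λ l → (toℕ l ≡ suc (toℕ k)) × TopPos σ k × TopPos σ l

BottomRep : {m : ℕ} → (Fin m → ℕ) → Fin m → Set
BottomRep {m} σ k = Σ (Fin m) λ l → (toℕ l ≡ suc (toℕ k)) × BottomPos σ k × BottomPos σ l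

record Proper (n m : ℕ) (σ : Fin m → ℕ) : Set where
  field
    isPerm      : IsPerm m σ
    contains21  : Contains p21 σ
    belowπ      : Contains σ (piPerm n)
    notπ        : ¬ SamePerm σ (piPerm n)
    oneDescent  : ExactlyOneInvDescent σ
    first-top   : ∀ (k : Fin m) → toℕ k ≡ 0 → TopPos σ k
    second-bot  : ∀ (k : Fin m) → toℕ k ≡ 1 → BottomPos σ k
    penult-top  : ∀ (k : Fin m) → suc (suc (toℕ k)) ≡ m → TopPos σ k
    last-bot    : ∀ (k : Fin m) → suc (toℕ k) ≡ m → BottomPos σ k
    topRep≤1    : ∀ k k' → TopRep σ k → TopRep σ k' → k ≡ k'
    botRep≤1    : ∀ k k' → BottomRep σ k → BottomRep σ k' → k ≡ k'
    topBeforeBot : ∀ k l → TopRep σ k → BottomRep σ l → k F.< l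

-- Let λ(i₀) = a + 1, λ(j₀) = a be the unique inverse descent of λ. Every letter of λ is a
-- top (value > a) or a bottom (value ≤ a), and within each class the letters increase from
-- left to right: an inversion inside one class would contain a second inverse descent.
-- Likewise π_n splits into the left/top positions, with increasing values n+1 < n+3 < ⋯,
-- and the bottom/right positions, with increasing values 1 < ⋯ < n < n+2; every value of
-- the first kind exceeds every value of the second, except left (n+1) < right (n+2).
-- So an increasing f realises the pattern of λ exactly when it sends tops to left/top and
-- bottoms to bottom/right positions without using both the left and the right position.
-- Conversely, since λ starts with a top and ends with a bottom, an embedding cannot send a
-- top to a bottom/right position (compare with the last letter), a bottom to a left/top
-- position (compare with the first letter), or use both the left and right positions.
module Submission where

open import Data.Nat using (ℕ; zero; suc; _*_; _+_; _∸_; _≤_; _<_; _≡ᵇ_; _/_; _%_; z≤n; s≤s; s≤s⁻¹; _≤?_)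
open import Data.Nat.Properties
open import Data.Nat.DivMod
open import Data.Nat.Divisibility using (divides-refl)
open import Data.Nat.Tactic.RingSolver using (solve-∀)
open import Data.Fin using (Fin; toℕ; fromℕ<; punchOut)
import Data.Fin as F
import Data.Fin.Properties as FP
open import Data.Bool using (true; false; T)
open import Data.Product using (Σ; ∃; _×_; _,_; proj₁; proj₂)
open import Data.Sum using (_⊎_; inj₁; inj₂; swap)
open import Function using (const)
open import Function.Bundles using (_⇔_; mk⇔)
open import Function.Definitions using (Injective)
open import Relation.Binary.PropositionalEquality
open import Relation.Binary.Definitions using (tri<; tri≈; tri>)
open import Relation.Nullary using (¬_; yes; no; contradiction)

open import Defs

≡ᵇ-false : ∀ {m n} → m ≢ n → (m ≡ᵇ n) ≡ false
≡ᵇ-false {m} {n} m≢n with m ≡ᵇ n in eq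
... | true  = contradiction (≡ᵇ⇒≡ m n (subst T (sym eq) _)) m≢n
... | false = refl

≡ᵇ-refl : ∀ m → (m ≡ᵇ m) ≡ true
≡ᵇ-refl zero    = refl
≡ᵇ-refl (suc m) = ≡ᵇ-refl m

[2*i]%2≡0 : ∀ i → 2 * i % 2 ≡ 0
[2*i]%2≡0 i rewrite *-comm 2 i = m*n%n≡0 i 2

[2*i]/2≡i : ∀ i → 2 * i / 2 ≡ i
[2*i]/2≡i i rewrite *-comm 2 i = m*n/n≡m i 2

[2*i+1]%2≡1 : ∀ i → (2 * i + 1) % 2 ≡ 1
[2*i+1]%2≡1 i rewrite +-comm (2 * i) 1 | *-comm 2 i = [m+kn]%n≡m%n 1 i 2

[2*i+1]/2≡i : ∀ i → (2 * i + 1) / 2 ≡ i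
[2*i+1]/2≡i i rewrite +-comm (2 * i) 1 | *-comm 2 i =
  trans (+-distrib-/-∣ʳ 1 {d = 2} (divides-refl i)) (m*n/n≡m i 2)

2*[1+n]≡2*n+2 : ∀ n → 2 * suc n ≡ 2 * n + 2
2*[1+n]≡2*n+2 = solve-∀

even≢1 : ∀ i → 2 * i ≢ 1
even≢1 i = even≢odd i 0

odd≢2*n+2 : ∀ i n → 2 * i + 1 ≢ 2 * n + 2
odd≢2*n+2 i n e = even≢odd (suc n) i (sym (trans (trans (+-comm 1 (2 * i)) e) (sym (2*[1+n]≡2*n+2 n))))

even-or-odd : ∀ q → ∃ λ i → q ≡ 2 * i ⊎ q ≡ 2 * i + 1
even-or-odd zero = 0 , inj₁ refl
even-or-odd (suc q) with even-or-odd q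
... | i , inj₁ refl = i , inj₂ (+-comm 1 (2 * i))
... | i , inj₂ refl = suc i , inj₁ (sym (trans (*-suc 2 i) (cong suc (+-comm 1 (2 * i)))))

1≤i⇒odd≢1 : ∀ {i} → 1 ≤ i → 2 * i + 1 ≢ 1
1≤i⇒odd≢1 {suc i} _ e with +-cancelʳ-≡ 1 (2 * suc i) 0 e
... | ()

module _ (n : ℕ) where

  piNat-right : piNat n (2 * n + 2) ≡ n + 2
  piNat-right rewrite ≡ᵇ-false (λ e → even≢1 (suc n) (trans (2*[1+n]≡2*n+2 n) e))
                    | ≡ᵇ-refl (2 * n + 2) = refl

  2*i≢2*n+2 : ∀ {i} → i ≤ n → 2 * i ≢ 2 * n + 2
  2*i≢2*n+2 i≤n e = <-irrefl e (≤-<-trans (*-monoʳ-≤ 2 i≤n) (m<m+n (2 * n) (s≤s z≤n)))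

  piNat-bottom : ∀ {i} → i ≤ n → piNat n (2 * i) ≡ i
  piNat-bottom {i} i≤n
    rewrite ≡ᵇ-false (even≢1 i) | ≡ᵇ-false (2*i≢2*n+2 i≤n) | [2*i]%2≡0 i = [2*i]/2≡i i

  piNat-top : ∀ {i} → 1 ≤ i → piNat n (2 * i + 1) ≡ n + 2 + i
  piNat-top {i} 1≤i
    rewrite ≡ᵇ-false (1≤i⇒odd≢1 1≤i) | ≡ᵇ-false (odd≢2*n+2 i n) | [2*i+1]%2≡1 i
    = cong (n + 2 +_) ([2*i+1]/2≡i i)

  HiPos LoPos : Fin (2 * n + 2) → Set
  HiPos p = LeftPos n p ⊎ TopPosπ n p
  LoPos p = BottomPosπ n p ⊎ RightPos n p

  piPerm-left : ∀ {p} → LeftPos n p → piPerm n p ≡ suc n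
  piPerm-left e = cong (piNat n) e

  piPerm-right : ∀ {p} → RightPos n p → piPerm n p ≡ 2 + n
  piPerm-right e = trans (cong (piNat n) e) (trans piNat-right (+-comm n 2))

  piPerm-bottom : ∀ {p} → ((i , _ , i≤n , _) : BottomPosπ n p) → piPerm n p ≡ i
  piPerm-bottom (i , _ , i≤n , e) = trans (cong (piNat n) e) (piNat-bottom i≤n)

  piPerm-top : ∀ {p} → ((i , _ , _ , _) : TopPosπ n p) → piPerm n p ≡ n + 2 + i
  piPerm-top (i , 1≤i , _ , e) = trans (cong (piNat n) e) (piNat-top 1≤i)

  piPerm-bottom≤n : ∀ {p} → BottomPosπ n p → piPerm n p ≤ n
  piPerm-bottom≤n b@(_ , _ , i≤n , _) = subst (_≤ n) (sym (piPerm-bottom b)) i≤n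

  3+n≤piPerm-top : ∀ {p} → TopPosπ n p → 3 + n ≤ piPerm n p
  3+n≤piPerm-top {p} t@(i , 1≤i , _ , _) = begin
    3 + n         ≡⟨ +-comm 3 n ⟩
    n + 3         ≡⟨ +-assoc n 2 1 ⟨
    n + 2 + 1     ≤⟨ +-monoʳ-≤ (n + 2) 1≤i ⟩
    n + 2 + i     ≡⟨ piPerm-top t ⟨
    piPerm n p    ∎
    where open ≤-Reasoning

  piPerm-bottom-increasing : ∀ {p q} → BottomPosπ n p → BottomPosπ n q → p F.< q → piPerm n p < piPerm n q
  piPerm-bottom-increasing bp@(i , _ , _ , e) bq@(j , _ , _ , e′) p<q =
    subst₂ _<_ (sym (piPerm-bottom bp)) (sym (piPerm-bottom bq))
      (*-cancelˡ-< 2 i j (subst₂ _<_ e e′ (s≤s p<q)))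

  piPerm-top-increasing : ∀ {p q} → TopPosπ n p → TopPosπ n q → p F.< q → piPerm n p < piPerm n q
  piPerm-top-increasing tp@(i , _ , _ , e) tq@(j , _ , _ , e′) p<q =
    subst₂ _<_ (sym (piPerm-top tp)) (sym (piPerm-top tq))
      (+-monoʳ-< (n + 2) (*-cancelˡ-< 2 i j (+-cancelʳ-< 1 _ _ (subst₂ _<_ e e′ (s≤s p<q)))))

  left-minimal : ∀ {p q : Fin (2 * n + 2)} → LeftPos n q → ¬ p F.< q
  left-minimal {p} e p<q = n≮0 (subst (toℕ p <_) (suc-injective e) p<q)

  right-maximal : ∀ {p q : Fin (2 * n + 2)} → RightPos n p → ¬ p F.< q
  right-maximal {q = q} e p<q = <-irrefl refl (<-≤-trans (FP.toℕ<n q) (subst (_≤ toℕ q) e p<q))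

  position-classes : ∀ p → HiPos p ⊎ LoPos p
  position-classes p with even-or-odd (suc (toℕ p)) | FP.toℕ<n p
  ... | zero  , inj₂ e | _ = inj₁ (inj₁ e)
  ... | suc i , inj₂ e | p<2n+2 = inj₁ (inj₂ (suc i , s≤s z≤n , i<n , e))
    where
    i<n : suc i ≤ n
    i<n = s≤s⁻¹ (*-cancelˡ-< 2 (suc i) (suc n)
            (subst₂ _≤_ (trans e (+-comm _ 1)) (sym (2*[1+n]≡2*n+2 n)) p<2n+2))
  ... | suc i , inj₁ e | p<2n+2 with suc i ≤? n
  ...   | yes i≤n = inj₂ (inj₁ (suc i , s≤s z≤n , i≤n , e))
  ...   | no  i≰n = inj₂ (inj₂ (trans e (trans (cong (2 *_) i≡1+n) (2*[1+n]≡2*n+2 n))))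
    where
    i≡1+n : suc i ≡ suc n
    i≡1+n = ≤-antisym (*-cancelˡ-≤ 2 (subst₂ _≤_ e (sym (2*[1+n]≡2*n+2 n)) p<2n+2)) (≰⇒> i≰n)

  piPerm-bottom<top : ∀ {p q} → BottomPosπ n p → TopPosπ n q → piPerm n p < piPerm n q
  piPerm-bottom<top b t = ≤-<-trans (piPerm-bottom≤n b) (≤-trans (m≤n+m (suc n) 2) (3+n≤piPerm-top t))

  piPerm-increasing-into-Hi : ∀ {p q} → p F.< q → HiPos q → piPerm n p < piPerm n q
  piPerm-increasing-into-Hi p<q (inj₁ l) = contradiction p<q (left-minimal l)
  piPerm-increasing-into-Hi {p} p<q (inj₂ t) with position-classes p
  ... | inj₁ (inj₁ l)  = subst (_< _) (sym (piPerm-left l)) (≤-trans (n≤1+n _) (3+n≤piPerm-top t))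
  ... | inj₁ (inj₂ t′) = piPerm-top-increasing t′ t p<q
  ... | inj₂ (inj₁ b)  = piPerm-bottom<top b t
  ... | inj₂ (inj₂ r)  = contradiction p<q (right-maximal r)

  piPerm-increasing-from-Lo : ∀ {p q} → p F.< q → LoPos p → piPerm n p < piPerm n q
  piPerm-increasing-from-Lo p<q (inj₂ r) = contradiction p<q (right-maximal r)
  piPerm-increasing-from-Lo {q = q} p<q (inj₁ b) with position-classes q
  ... | inj₁ (inj₁ l)  = contradiction p<q (left-minimal l)
  ... | inj₁ (inj₂ t)  = piPerm-bottom<top b t
  ... | inj₂ (inj₁ b′) = piPerm-bottom-increasing b b′ p<q
  ... | inj₂ (inj₂ r)  = subst (_ <_) (sym (piPerm-right r)) (≤-trans (s≤s (piPerm-bottom≤n b)) (n≤1+n _))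

  piPerm-Lo<Hi : ∀ {p q} → LoPos p → HiPos q → ¬ (LeftPos n q × RightPos n p) → piPerm n p < piPerm n q
  piPerm-Lo<Hi (inj₁ b) (inj₁ l) _ = subst (_ <_) (sym (piPerm-left l)) (s≤s (piPerm-bottom≤n b))
  piPerm-Lo<Hi (inj₁ b) (inj₂ t) _ = piPerm-bottom<top b t
  piPerm-Lo<Hi (inj₂ r) (inj₁ l) ¬lr = contradiction (l , r) ¬lr
  piPerm-Lo<Hi (inj₂ r) (inj₂ t) _ = subst (_< _) (sym (piPerm-right r)) (3+n≤piPerm-top t)

  piPerm-left<right : ∀ {p q} → LeftPos n p → RightPos n q → piPerm n p < piPerm n q
  piPerm-left<right l r = subst₂ _<_ (sym (piPerm-left l)) (sym (piPerm-right r)) ≤-refl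

first-position : ∀ {m} → Fin m → Σ (Fin m) λ z → toℕ z ≡ 0 × (∀ (k : Fin m) → z F.≤ k)
first-position F.zero    = F.zero , refl , λ _ → z≤n
first-position (F.suc _) = F.zero , refl , λ _ → z≤n

last-position : ∀ {m} → Fin m → Σ (Fin m) λ l → suc (toℕ l) ≡ m × (∀ (k : Fin m) → k F.≤ l)
last-position {suc m} _ = F.fromℕ m , cong suc (FP.toℕ-fromℕ m) , λ k → FP.≤fromℕ k

adjacent-increasing⇒increasing : ∀ {m} {h : Fin m → ℕ} →
  (∀ i j → toℕ j ≡ suc (toℕ i) → h i < h j) → ∀ {i j} → i F.< j → h i < h j
adjacent-increasing⇒increasing {m} {h} adj {i} {j} i<j = climb (toℕ j ∸ suc (toℕ i)) j (m∸n+n≡m i<j)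
  where
  climb : ∀ d j → d + suc (toℕ i) ≡ toℕ j → h i < h j
  climb zero    j e = adj i j (sym e)
  climb (suc d) j e =
    <-trans (climb d j′ (sym (FP.toℕ-fromℕ< _))) (adj j′ j (trans (sym e) (cong suc (sym (FP.toℕ-fromℕ< _)))))
    where
    j′ : Fin m
    j′ = fromℕ< {d + suc (toℕ i)} (<-trans (subst (_ <_) e (n<1+n _)) (FP.toℕ<n j))

agreement⇒same-order : ∀ {x y u v : ℕ} →
  (x < y × u < v) ⊎ (y < x × v < u) → (x < y → u < v) × (u < v → x < y)
agreement⇒same-order (inj₁ (x<y , u<v)) = const u<v , const x<y
agreement⇒same-order (inj₂ (y<x , v<u)) =
  (λ x<y → contradiction y<x (<-asym x<y)) , (λ u<v → contradiction v<u (<-asym u<v))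

pairwise-agreement⇒OrderIso : ∀ {k} {σ τ : Fin k → ℕ} →
  (∀ i j → i F.< j → (σ i < σ j × τ i < τ j) ⊎ (σ j < σ i × τ j < τ i)) → OrderIso σ τ
pairwise-agreement⇒OrderIso agree i j with FP.<-cmp i j
... | tri< i<j _ _ = agreement⇒same-order (agree i j i<j)
... | tri≈ _ refl _ =
  (λ σi<σi → contradiction σi<σi (<-irrefl refl)) , (λ τi<τi → contradiction τi<τi (<-irrefl refl))
... | tri> _ _ j<i = agreement⇒same-order (swap (agree j i j<i))

Fin-injective⇒surjective : ∀ {m} {g : Fin m → Fin m} → Injective _≡_ _≡_ g → ∀ y → ∃ λ x → g x ≡ y
Fin-injective⇒surjective {suc m} {g} g-inj y with FP.any? (λ x → g x FP.≟ y)
... | yes hit = hit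
... | no  miss = contradiction (FP.injective⇒≤ squeezed-inj) (<-irrefl refl)
  where
  y∉image : ∀ x → y ≢ g x
  y∉image x y≡gx = miss (x , sym y≡gx)
  squeezed : Fin (suc m) → Fin m
  squeezed x = punchOut (y∉image x)
  squeezed-inj : Injective _≡_ _≡_ squeezed
  squeezed-inj {x} {x′} e = g-inj (FP.punchOut-injective (y∉image x) (y∉image x′) e)

value-index : ∀ {m x} → (1 ≤ x) × (x ≤ m) → Fin m
value-index {x = suc x} (_ , x<m) = fromℕ< x<m

value-index-injective : ∀ {m x y} (bx : (1 ≤ x) × (x ≤ m)) (by : (1 ≤ y) × (y ≤ m)) →
  value-index bx ≡ value-index by → x ≡ y
value-index-injective {x = suc x} {suc y} (_ , x<m) (_ , y<m) e = cong suc (FP.fromℕ<-injective x y x<m y<m e)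

IsPerm-surjective : ∀ {m σ} → IsPerm m σ → ∀ {w} → 1 ≤ w → w ≤ m → ∃ λ p → σ p ≡ w
IsPerm-surjective (bounded , σ-inj) 1≤w w≤m
  with p , e ← Fin-injective⇒surjective {g = λ p → value-index (bounded p)}
                 (λ {p} {q} e → σ-inj (value-index-injective (bounded p) (bounded q) e))
                 (value-index (1≤w , w≤m))
  = p , value-index-injective (bounded p) (1≤w , w≤m) e

-- The value σ l + 1 sits left of l, giving the descent, or right of l, where it forms a
-- narrower inversion with k.
inversion⇒inverse-descent : ∀ {m σ} → IsPerm m σ → ∀ {k l : Fin m} → k F.< l → σ l < σ k →
  ∃ λ p → ∃ λ q → InvDescent σ p q × σ l ≤ σ q × σ q < σ k
inversion⇒inverse-descent {m} {σ} perm@(bounded , σ-inj) {k} {l} k<l σl<σk =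
  descend (σ k) k<l σl<σk (m≤m+n (σ k) (σ l))
  where
  descend : ∀ d {l} → k F.< l → σ l < σ k → σ k ≤ d + σ l →
            ∃ λ p → ∃ λ q → InvDescent σ p q × σ l ≤ σ q × σ q < σ k
  descend zero    _   σl<σk σk≤σl = contradiction σk≤σl (<⇒≱ σl<σk)
  descend (suc d) {l} k<l σl<σk σk≤d+σl
    with IsPerm-surjective perm {suc (σ l)} (s≤s z≤n) (≤-trans σl<σk (proj₂ (bounded k)))
  ... | p , σp≡1+σl with FP.<-cmp p l
  ...   | tri< p<l _ _ = p , l , (p<l , trans σp≡1+σl (+-comm 1 (σ l))) , ≤-refl , σl<σk
  ...   | tri≈ _ refl _ = contradiction σp≡1+σl (λ e → <-irrefl e (n<1+n (σ l)))
  ...   | tri> _ _ l<p with descend d (FP.<-trans k<l l<p) σp<σk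
                          (subst (σ k ≤_) (trans (sym (+-suc d (σ l))) (cong (d +_) (sym σp≡1+σl))) σk≤d+σl)
    where
    σp<σk : σ p < σ k
    σp<σk = ≤∧≢⇒< (subst (_≤ σ k) (sym σp≡1+σl) σl<σk)
              (λ σp≡σk → FP.<-irrefl refl (FP.<-trans k<l (subst (l F.<_) (σ-inj σp≡σk) l<p)))
  ...     | p′ , q′ , d′ , σp≤σq′ , σq′<σk =
            p′ , q′ , d′ , ≤-trans (n≤1+n (σ l)) (subst (_≤ σ q′) σp≡1+σl σp≤σq′) , σq′<σk

module UniqueInverseDescent {m} {σ : Fin m → ℕ} (perm : IsPerm m σ) (one : ExactlyOneInvDescent σ) where

  i₀ j₀ : Fin m
  i₀ = proj₁ one
  j₀ = proj₁ (proj₂ one)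

  descent₀ : InvDescent σ i₀ j₀
  descent₀ = proj₁ (proj₂ (proj₂ one))

  a : ℕ
  a = σ j₀

  descent-bottom : ∀ {p q} → InvDescent σ p q → σ q ≡ a
  descent-bottom {p} {q} d = cong σ (proj₂ (proj₂ (proj₂ (proj₂ one)) p q d))

  TopPos⇒a<σ : ∀ {k} → TopPos σ k → a < σ k
  TopPos⇒a<σ {k} (_ , _ , d , σi≤σk) =
    subst (_≤ σ k) (trans (proj₂ d) (trans (+-comm _ 1) (cong suc (descent-bottom d)))) σi≤σk

  BottomPos⇒σ≤a : ∀ {k} → BottomPos σ k → σ k ≤ a
  BottomPos⇒σ≤a {k} (_ , _ , d , σk≤σj) = subst (σ k ≤_) (descent-bottom d) σk≤σj

  top-or-bottom : ∀ k → TopPos σ k ⊎ BottomPos σ k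
  top-or-bottom k with σ k ≤? a
  ... | yes σk≤a = inj₂ (i₀ , j₀ , descent₀ , σk≤a)
  ... | no  σk≰a =
    inj₁ (i₀ , j₀ , descent₀ , subst (_≤ σ k) (sym (trans (proj₂ descent₀) (+-comm a 1))) (≰⇒> σk≰a))

  bottom<top : ∀ {k l} → BottomPos σ l → TopPos σ k → σ l < σ k
  bottom<top b t = ≤-<-trans (BottomPos⇒σ≤a b) (TopPos⇒a<σ t)

  increasing-into-top : ∀ {k l} → k F.< l → TopPos σ l → σ k < σ l
  increasing-into-top {k} {l} k<l t with <-cmp (σ k) (σ l)
  ... | tri< σk<σl _ _ = σk<σl
  ... | tri≈ _ σk≡σl _ = contradiction (proj₂ perm σk≡σl) (λ k≡l → FP.<-irrefl k≡l k<l)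
  ... | tri> _ _ σl<σk with inversion⇒inverse-descent perm k<l σl<σk
  ...   | _ , _ , d , σl≤σq , _ =
    contradiction (subst (σ l ≤_) (descent-bottom d) σl≤σq) (<⇒≱ (TopPos⇒a<σ t))

  increasing-from-bottom : ∀ {k l} → k F.< l → BottomPos σ k → σ k < σ l
  increasing-from-bottom {k} {l} k<l b with <-cmp (σ k) (σ l)
  ... | tri< σk<σl _ _ = σk<σl
  ... | tri≈ _ σk≡σl _ = contradiction (proj₂ perm σk≡σl) (λ k≡l → FP.<-irrefl k≡l k<l)
  ... | tri> _ _ σl<σk with inversion⇒inverse-descent perm k<l σl<σk
  ...   | _ , _ , d , _ , σq<σk =
    contradiction (subst (_< σ k) (descent-bottom d) σq<σk) (≤⇒≯ (BottomPos⇒σ≤a b))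

module _ {n m : ℕ} {σ : Fin m → ℕ} (P : Proper n m σ) (f : Fin m → Fin (2 * n + 2)) where
  open Proper P
  open UniqueInverseDescent isPerm oneDescent

  private
    W : Fin m → ℕ
    W i = piPerm n (f i)

  AdjacentIncreasing : Set
  AdjacentIncreasing = ∀ (i j : Fin m) → toℕ j ≡ suc (toℕ i) → f i F.< f j

  TopsToHi : Set
  TopsToHi = ∀ i → TopPos σ i → HiPos n (f i)

  BottomsToLo : Set
  BottomsToLo = ∀ i → BottomPos σ i → LoPos n (f i)

  NotLeftAndRight : Set
  NotLeftAndRight = ¬ ((∃ λ i → LeftPos n (f i)) × (∃ λ j → RightPos n (f j)))

  private
    top≢bottom : ∀ {k l} → TopPos σ k → BottomPos σ l → k ≢ l
    top≢bottom t b refl = <-irrefl refl (bottom<top b t)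

  module _ (embedding : IsEmbedding σ (piPerm n) f) where
    private
      increasing : ∀ i j → i F.< j → f i F.< f j
      increasing = proj₁ embedding

      iso : OrderIso σ W
      iso = proj₂ embedding

    embedding-adjacent-increasing : AdjacentIncreasing
    embedding-adjacent-increasing i j j≡1+i = increasing i j (≤-reflexive (sym j≡1+i))

    embedding-tops-to-Hi : TopsToHi
    embedding-tops-to-Hi k t with position-classes n (f k)
    ... | inj₁ hi = hi
    ... | inj₂ lo with last-position k
    ...   | l , l-last , k≤l = contradiction (proj₁ (iso l k) (bottom<top b t))
                                  (<⇒≯ (piPerm-increasing-from-Lo n (increasing k l k<l) lo))
      where
      b : BottomPos σ l
      b = last-bot l l-last
      k<l : k F.< l
      k<l = FP.≤∧≢⇒< (k≤l k) (top≢bottom t b)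

    embedding-bottoms-to-Lo : BottomsToLo
    embedding-bottoms-to-Lo k b with position-classes n (f k)
    ... | inj₂ lo = lo
    ... | inj₁ hi with first-position k
    ...   | z , z-first , z≤k = contradiction (proj₁ (iso k z) (bottom<top b t))
                                  (<⇒≯ (piPerm-increasing-into-Hi n (increasing z k z<k) hi))
      where
      t : TopPos σ z
      t = first-top z z-first
      z<k : z F.< k
      z<k = FP.≤∧≢⇒< (z≤k k) (top≢bottom t b)

    embedding-not-left-and-right : NotLeftAndRight
    embedding-not-left-and-right ((i , left) , (j , right)) =
      contradiction (proj₁ (iso j i) (bottom<top (last-bot j j-last) (first-top i i-first)))
                    (<⇒≯ (piPerm-left<right n left right))
      where
      i-first : toℕ i ≡ 0
      i-first with first-position i
      ... | z , z-first , z≤i with m≤n⇒m<n∨m≡n (z≤i i)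
      ...   | inj₁ z<i  = contradiction (increasing z i z<i) (left-minimal n left)
      ...   | inj₂ z≡i  = trans (sym z≡i) z-first
      j-last : suc (toℕ j) ≡ m
      j-last with last-position j
      ... | l , l-last , j≤l with m≤n⇒m<n∨m≡n (j≤l j)
      ...   | inj₁ j<l  = contradiction (increasing j l j<l) (right-maximal n right)
      ...   | inj₂ j≡l  = trans (cong suc j≡l) l-last

  module _ (adjacent : AdjacentIncreasing) (tops : TopsToHi) (bottoms : BottomsToLo)
           (not-left-right : NotLeftAndRight) where

    conditions-increasing : ∀ {i j} → i F.< j → f i F.< f j
    conditions-increasing = adjacent-increasing⇒increasing {h = λ i → toℕ (f i)} adjacent

    conditions-agree : ∀ i j → i F.< j → (σ i < σ j × W i < W j) ⊎ (σ j < σ i × W j < W i)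
    conditions-agree i j i<j with top-or-bottom i | top-or-bottom j
    ... | _      | inj₁ tj = inj₁ (increasing-into-top i<j tj ,
                                   piPerm-increasing-into-Hi n (conditions-increasing i<j) (tops j tj))
    ... | inj₂ bi | inj₂ _ = inj₁ (increasing-from-bottom i<j bi ,
                                   piPerm-increasing-from-Lo n (conditions-increasing i<j) (bottoms i bi))
    ... | inj₁ ti | inj₂ bj = inj₂ (bottom<top bj ti ,
                                    piPerm-Lo<Hi n (bottoms j bj) (tops i ti)
                                      λ (l , r) → not-left-right ((i , l) , (j , r)))

    conditions-embedding : IsEmbedding σ (piPerm n) f
    conditions-embedding = (λ i j → conditions-increasing) , pairwise-agreement⇒OrderIso conditions-agree

lemma19 : (n : ℕ) → 2 ≤ n → (m : ℕ) → (σ : Fin m → ℕ) → Proper n m σ →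
    (f : Fin m → Fin (2 * n + 2)) →
    IsEmbedding σ (piPerm n) f ⇔
      ((∀ (i j : Fin m) → toℕ j ≡ suc (toℕ i) → f i F.< f j)
       × (∀ (i : Fin m) → TopPos σ i → LeftPos n (f i) ⊎ TopPosπ n (f i))
       × (∀ (i : Fin m) → BottomPos σ i → BottomPosπ n (f i) ⊎ RightPos n (f i))
       × ¬ ((∃ λ i → LeftPos n (f i)) × (∃ λ j → RightPos n (f j))))
lemma19 n _ m σ P f = mk⇔
  (λ emb → embedding-adjacent-increasing P f emb , embedding-tops-to-Hi P f emb ,
           embedding-bottoms-to-Lo P f emb , embedding-not-left-and-right P f emb)
  (λ (adjacent , tops , bottoms , not-left-right) → conditions-embedding P f adjacent tops bottoms not-left-right)
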